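{- Fix any finite sequence $X=x_1,\dots,x_m$ of pairing-heap operations executed on an initially empty collection of pairing heaps, and let $\Phi_0,\dots,\Phi_m$ be the potential defined in the context. Then $\Phi_m-\Phi_0\ge 0$.
   Context: A pairing heap is a heap-ordered (min-heap) rooted ordered tree; the operations (Make-Heap, Insert, Meld, Find-Min, Delete, Decrease-Key, Extract-Min) restructure it by pairing roots (the root with the larger key becomes the leftmost child of the other). $\Phi_i$ denotes the potential after executing $x_i$, defined as follows. Binary representation: each node's left child is its leftmost child and its right child is its immediate right sibling. A node is black if it remains in the collection of heaps at the end of $X$, white otherwise. For a node $x$, $s(x)$ is the number of white nodes in the subtree of $x$ in the binary representation (including $x$). A white node is heavy if the number of white nodes in its left binary subtree is at least the number in its right binary subtree, and light otherwise. A node is captured if its parent (in the heap tree) exists and is black. Node potential of a white node $x$: rank potential $18\log_2 s(x)$; plus triple-white potential $0$ if $x$ has an immediate left sibling and an immediate right sibling that are both white, and $6$ otherwise; plus weight potential $0$ if heavy and $6$ if light; plus capture potential $0$ if captured and $6$ otherwise. The node potential of a black node is only its capture potential ($0$ if captured, $6$ otherwise). Each heap with $k$ white nodes has heap potential $8-36\sum_{j=1}^{k}\log_2 j$. $\Phi_i$ is the sum of all node potentials and heap potentials in the collection after executing $x_i$, and $\Phi_0=0$ (empty collection). -}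

module Defs where

open import Data.Nat using (ℕ; zero; suc; _+_; _*_; _^_; _≤_; _≤ᵇ_; _<ᵇ_; _≡ᵇ_)
open import Data.Integer using (ℤ; +_; -[1+_]) renaming (_-_ to _-ℤ_)
open import Data.Bool using (Bool; true; false; if_then_else_; _∧_; _∨_; not)
open import Data.List using (List; []; _∷_; _++_; map; length; take; foldl)
open import Data.Bool.ListAction using (any)
open import Data.Maybe using (Maybe; just; nothing)
open import Data.Product using (_×_; _,_)

-- Pairing heaps as rooted ordered trees.
-- A node carries an identifier (ℕ) and a key (ℕ); children are listed
-- left to right (the first element is the leftmost child).

data Tree : Set where
  node : (ident key : ℕ) → List Tree → Tree

Heap : Set
Heap = Maybe Tree

link : Tree → Tree → Tree
link (node i a cs) (node j b ds) =
  if b <ᵇ a then node j b (node i a cs ∷ ds) else node i a (node j b ds ∷ cs)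

meldH : Heap → Heap → Heap
meldH nothing h = h
meldH (just t) nothing = just t
meldH (just t) (just u) = just (link t u)

pass1 : List Tree → List Tree
pass1 [] = []
pass1 (t ∷ []) = t ∷ []
pass1 (t ∷ u ∷ ts) = link t u ∷ pass1 ts

pass2 : List Tree → Heap
pass2 [] = nothing
pass2 (t ∷ ts) with pass2 ts
... | nothing = just t
... | just r = just (link t r)

pairChildren : List Tree → Heap
pairChildren cs = pass2 (pass1 cs)

mutual
  removeT : ℕ → Tree → Maybe (Tree × Tree)
  removeT x (node i k cs) with removeF x cs
  ... | nothing = nothing
  ... | just (s , cs') = just (s , node i k cs')

  removeF : ℕ → List Tree → Maybe (Tree × List Tree)
  removeF x [] = nothing
  removeF x (node i k cs ∷ ts) with i ≡ᵇ x
  ... | true = just (node i k cs , ts)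
  ... | false with removeT x (node i k cs)
  ...   | just (s , t') = just (s , t' ∷ ts)
  ...   | nothing with removeF x ts
  ...     | nothing = nothing
  ...     | just (s , ts') = just (s , node i k cs ∷ ts')

extractMinH : Heap → Heap
extractMinH nothing = nothing
extractMinH (just (node i k cs)) = pairChildren cs

deleteH : ℕ → Heap → Heap
deleteH x nothing = nothing
deleteH x (just (node r kr cs)) with r ≡ᵇ x
... | true = pairChildren cs
... | false with removeT x (node r kr cs)
...   | nothing = just (node r kr cs)
...   | just (node _ _ ds , rest) = meldH (just rest) (pairChildren ds)

decreaseKeyH : ℕ → ℕ → Heap → Heap
decreaseKeyH x k nothing = nothing
decreaseKeyH x k (just (node r kr cs)) with r ≡ᵇ x
... | true = if k ≤ᵇ kr then just (node r k cs) else just (node r kr cs)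
... | false with removeT x (node r kr cs)
...   | nothing = just (node r kr cs)
...   | just (node y ky ds , rest) =
          if k ≤ᵇ ky then just (link rest (node y k ds)) else just (node r kr cs)

-- Heaps in the collection are referred to by their position in the list.
-- Operations whose arguments are invalid (nonexistent heap, node not in the
-- heap, a "decrease" to a larger key, melding a heap with itself) do nothing.

data Op : Set where
  makeHeap    : Op
  insert      : (h key : ℕ) → Op        -- inserts a fresh node
  meld        : (h₁ h₂ : ℕ) → Op
  findMin     : (h : ℕ) → Op
  delete      : (h x : ℕ) → Op
  decreaseKey : (h x key : ℕ) → Op
  extractMin  : (h : ℕ) → Op

record State : Set where
  constructor state
  field
    heaps : List Heap
    fresh : ℕ

open State public

getAt : List Heap → ℕ → Maybe Heap
getAt [] _ = nothing
getAt (h ∷ hs) zero = just h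
getAt (h ∷ hs) (suc n) = getAt hs n

setAt : List Heap → ℕ → Heap → List Heap
setAt [] _ _ = []
setAt (h ∷ hs) zero h' = h' ∷ hs
setAt (h ∷ hs) (suc n) h' = h ∷ setAt hs n h'

removeAt : List Heap → ℕ → List Heap
removeAt [] _ = []
removeAt (h ∷ hs) zero = hs
removeAt (h ∷ hs) (suc n) = h ∷ removeAt hs n

modifyAt : ℕ → (Heap → Heap) → List Heap → List Heap
modifyAt n f hs with getAt hs n
... | nothing = hs
... | just h = setAt hs n (f h)

step : State → Op → State
step (state hs n) makeHeap = state (hs ++ (nothing ∷ [])) n
step (state hs n) (insert h k) with getAt hs h
... | nothing = state hs n
... | just H = state (setAt hs h (meldH H (just (node n k [])))) (suc n)
step (state hs n) (meld h₁ h₂) with h₁ ≡ᵇ h₂ | getAt hs h₁ | getAt hs h₂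
... | false | just H₁ | just H₂ = state (removeAt (setAt hs h₁ (meldH H₁ H₂)) h₂) n
... | _ | _ | _ = state hs n
step s (findMin h) = s
step (state hs n) (delete h x) = state (modifyAt h (deleteH x) hs) n
step (state hs n) (decreaseKey h x k) = state (modifyAt h (decreaseKeyH x k) hs) n
step (state hs n) (extractMin h) = state (modifyAt h extractMinH hs) n

initial : State
initial = state [] 0

run : List Op → State
run = foldl step initial

stateAfter : List Op → ℕ → State
stateAfter X i = run (take i X)

-- Exact arithmetic for expressions  c + Σ aⱼ·log₂ nⱼ  (c, aⱼ ∈ ℤ, nⱼ ≥ 1).

record LogExpr : Set where
  constructor logExpr
  field
    const : ℤ
    terms : List (ℤ × ℕ)   -- (a , n) stands for a·log₂ n

open LogExpr public

zeroE : LogExpr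
zeroE = logExpr (+ 0) []

constE : ℤ → LogExpr
constE c = logExpr c []

logE : ℤ → ℕ → LogExpr
logE a n = logExpr (+ 0) ((a , n) ∷ [])

_⊕_ : LogExpr → LogExpr → LogExpr
logExpr c ts ⊕ logExpr d us = logExpr (c Data.Integer.+ d) (ts ++ us)

negZ : ℤ → ℤ
negZ = Data.Integer.-_

_⊖_ : LogExpr → LogExpr → LogExpr
e ⊖ logExpr d us = e ⊕ logExpr (negZ d) (map (λ { (a , n) → (negZ a , n) }) us)

posPart negPart : ℤ → ℕ
posPart (+ k) = k
posPart -[1+ k ] = 0
negPart (+ k) = 0
negPart -[1+ k ] = suc k

posProd negProd : List (ℤ × ℕ) → ℕ
posProd [] = 1
posProd ((a , n) ∷ ts) = n ^ posPart a * posProd ts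
negProd [] = 1
negProd ((a , n) ∷ ts) = n ^ negPart a * negProd ts

-- c + Σ aⱼ log₂ nⱼ ≥ 0   ⇔   2^{c⁺} Π nⱼ^{aⱼ⁺} ≥ 2^{c⁻} Π nⱼ^{aⱼ⁻}
NonNeg : LogExpr → Set
NonNeg (logExpr c ts) = 2 ^ negPart c * negProd ts ≤ 2 ^ posPart c * posProd ts

-- The potential.  `black i` says whether node i remains in the collection at
-- the end of X; all other nodes are white.

module Potential (black : ℕ → Bool) where

  white : ℕ → Bool
  white i = not (black i)

  mutual
    wT : Tree → ℕ
    wT (node i k cs) = (if white i then 1 else 0) + wF cs

    wF : List Tree → ℕ
    wF [] = 0
    wF (t ∷ ts) = wT t + wF ts

  rootWhite : List Tree → Bool   -- is there a white immediate right sibling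
  rootWhite [] = false
  rootWhite (node j _ _ ∷ _) = white j

  capPot : Bool → LogExpr
  capPot captured = if captured then zeroE else constE (+ 6)

  -- potential of the nodes in a list of siblings (and their descendants).
  -- captured : the parent exists and is black.
  -- leftWhite : there is an immediate left sibling and it is white.
  mutual
    potF : (captured leftWhite : Bool) → List Tree → LogExpr
    potF cap lw [] = zeroE
    potF cap lw (node i k cs ∷ ts) =
      nodePot cap lw i cs ts ⊕ (potF (black i) false cs ⊕ potF cap (white i) ts)

    nodePot : Bool → Bool → ℕ → List Tree → List Tree → LogExpr
    nodePot cap lw i cs ts =
      if white i
      then (logE (+ 18) (suc (wF cs + wF ts))                 -- rank: s(x) = 1 + left + right
           ⊕ (constE (if lw ∧ rootWhite ts then + 0 else + 6)
           ⊕ (constE (if wF ts ≤ᵇ wF cs then + 0 else + 6)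
           ⊕ capPot cap)))
      else capPot cap

  logFact : ℕ → LogExpr
  logFact zero = zeroE
  logFact (suc k) = logE (+ 36) (suc k) ⊕ logFact k

  heapPot : Heap → LogExpr
  heapPot nothing = constE (+ 8)
  heapPot (just t) = (constE (+ 8) ⊖ logFact (wT t)) ⊕ potF false false (t ∷ [])

  collectionPot : List Heap → LogExpr
  collectionPot [] = zeroE
  collectionPot (h ∷ hs) = heapPot h ⊕ collectionPot hs

mutual
  idsT : Tree → List ℕ
  idsT (node i k cs) = i ∷ idsF cs

  idsF : List Tree → List ℕ
  idsF [] = []
  idsF (t ∷ ts) = idsT t ++ idsF ts

idsH : List Heap → List ℕ
idsH [] = []
idsH (nothing ∷ hs) = idsH hs
idsH (just t ∷ hs) = idsT t ++ idsH hs

blackIn : List Op → ℕ → Bool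
blackIn X i = any (λ j → j ≡ᵇ i) (idsH (heaps (run X)))

Φ : List Op → ℕ → LogExpr
Φ X i = Potential.collectionPot (blackIn X) (heaps (stateAfter X i))

-- Every node still in the collection at the end of X is black by definition, so the
-- final collection has no white nodes: the rank, triple-white and weight potentials are
-- all absent and each heap potential is 8 − 36·(empty sum) = 8.  Hence Φₘ is a sum of
-- the nonnegative constants 0, 6 and 8, while Φ₀ = 0 for the empty collection.
module Submission where

open import Defs
open import Data.Bool using (Bool; true; false; T; if_then_else_)
open import Data.Bool.ListAction using (any)
open import Data.Integer using (+_)
open import Data.List using (List; []; _∷_; length)
open import Data.List.Properties using (take-all)
open import Data.List.Membership.Propositional using (_∈_)
open import Data.List.Relation.Unary.All as All using (All; []; _∷_)
open import Data.List.Relation.Unary.All.Properties using (++⁻; ++⁻ˡ; ++⁻ʳ; ++⁺)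
import Data.List.Relation.Unary.Any as Any
open import Data.List.Relation.Unary.Any.Properties using (any⁺)
open import Data.Maybe using (just; nothing)
open import Data.Nat using (ℕ; _+_; _≡ᵇ_)
open import Data.Nat.Properties using (≡⇒≡ᵇ; m^n>0; *-monoˡ-≤; ≤-refl)
open import Data.Product using (∃-syntax; _,_)
open import Function using (_∘_)
open import Relation.Binary.PropositionalEquality using (_≡_; refl; sym; cong₂; subst)

NatConst : LogExpr → Set
NatConst e = ∃[ k ] e ≡ constE (+ k)

natConst-zeroE : NatConst zeroE
natConst-zeroE = 0 , refl

natConst-⊕ : ∀ {e f} → NatConst e → NatConst f → NatConst (e ⊕ f)
natConst-⊕ (a , refl) (b , refl) = a + b , refl

natConst⇒nonNeg : ∀ {e} → NatConst e → NonNeg (e ⊖ zeroE)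
natConst⇒nonNeg (k , refl) = *-monoˡ-≤ 1 (m^n>0 2 (k + 0))

module _ (black : ℕ → Bool) where
  open Potential black

  AllBlack : List ℕ → Set
  AllBlack = All (T ∘ black)

  natConst-capPot : ∀ cap → NatConst (capPot cap)
  natConst-capPot true  = natConst-zeroE
  natConst-capPot false = 6 , refl

  nodePot-black : ∀ {cap lw i} cs ts → T (black i) → nodePot cap lw i cs ts ≡ capPot cap
  nodePot-black {i = i} cs ts bi with black i
  ... | true = refl

  whiteCount-black : ∀ {i} → T (black i) → (if white i then 1 else 0) ≡ 0
  whiteCount-black {i} bi with black i
  ... | true = refl

  mutual
    wT-allBlack : ∀ t → AllBlack (idsT t) → wT t ≡ 0
    wT-allBlack (node i k cs) (bi ∷ bcs) = cong₂ _+_ (whiteCount-black bi) (wF-allBlack cs bcs)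

    wF-allBlack : ∀ ts → AllBlack (idsF ts) → wF ts ≡ 0
    wF-allBlack []       _  = refl
    wF-allBlack (t ∷ ts) bs = cong₂ _+_ (wT-allBlack t (++⁻ˡ (idsT t) bs))
                                        (wF-allBlack ts (++⁻ʳ (idsT t) bs))

  potF-natConst : ∀ cap lw ts → AllBlack (idsF ts) → NatConst (potF cap lw ts)
  potF-natConst cap lw [] _ = natConst-zeroE
  potF-natConst cap lw (node i k cs ∷ ts) bs with ++⁻ (i ∷ idsF cs) bs
  ... | bi ∷ bcs , bts rewrite nodePot-black {cap} {lw} cs ts bi =
    natConst-⊕ (natConst-capPot cap)
      (natConst-⊕ (potF-natConst (black i) false cs bcs) (potF-natConst cap (white i) ts bts))

  heapPot-natConst : ∀ t → AllBlack (idsT t) → NatConst (heapPot (just t))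
  heapPot-natConst t bt = natConst-⊕ rootTerm (potF-natConst false false (t ∷ []) (++⁺ bt []))
    where
    rootTerm : NatConst (constE (+ 8) ⊖ logFact (wT t))
    rootTerm = subst (λ w → NatConst (constE (+ 8) ⊖ logFact w)) (sym (wT-allBlack t bt)) (8 , refl)

  collectionPot-natConst : ∀ hs → AllBlack (idsH hs) → NatConst (collectionPot hs)
  collectionPot-natConst []             _  = natConst-zeroE
  collectionPot-natConst (nothing ∷ hs) bs = natConst-⊕ (8 , refl) (collectionPot-natConst hs bs)
  collectionPot-natConst (just t ∷ hs)  bs =
    natConst-⊕ (heapPot-natConst t (++⁻ˡ (idsT t) bs)) (collectionPot-natConst hs (++⁻ʳ (idsT t) bs))

any-≡ᵇ-∈ : ∀ {x xs} → x ∈ xs → T (any (_≡ᵇ x) xs)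
any-≡ᵇ-∈ {x} x∈xs = any⁺ (_≡ᵇ x) (Any.map (λ x≡y → ≡⇒≡ᵇ _ x (sym x≡y)) x∈xs)

remaining-black : ∀ X → AllBlack (blackIn X) (idsH (heaps (run X)))
remaining-black X = All.tabulate any-≡ᵇ-∈

lemma6 : (X : List Op) → NonNeg (Φ X (length X) ⊖ Φ X 0)
lemma6 X rewrite take-all (length X) X ≤-refl =
  natConst⇒nonNeg (collectionPot-natConst (blackIn X) (heaps (run X)) (remaining-black X))
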